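{- Let $A=(a,b)$ and $B=(c,d)$ be lattice points, let $m\ge 0$, and let $S_i=(x_i,y_i)$, $i=1,\dots,m$, be lattice points with $a\le x_i\le c$ and $b\le y_i\le d$. Then every lattice path from $A$ to $B$ which stays weakly south-east of $S_i$ for all $i=1,\dots,m$ has at most $$\min\bigl\{c-a,\; d-b,\; c-b-\max\{x_i-y_i:1\le i\le m\}\bigr\}$$ NE-turns (for $m=0$ the third entry of the minimum is omitted), and this number is attained. For instance, it is attained by a path consisting of a straight horizontal piece at the beginning, followed by a zig-zag path passing through one of the points $S_j$ for which $x_j-y_j=\max\{x_i-y_i:1\le i\le m\}$, followed by a straight vertical piece at the end, as necessary to connect $A$ with $B$.
   Context: A lattice path is a finite sequence $A_0,A_1,\dots,A_m$ of points of $\mathbb Z^2$ with $A_k-A_{k-1}\in\{(1,0),(0,1)\}$ for all $k$; it runs from $A_0$ to $A_m$. A zig-zag path is a lattice path whose successive steps alternate between $(1,0)$ and $(0,1)$. A NE-turn of a lattice path is a point of the path which is the end point of a vertical step $(0,1)$ and at the same time the starting point of a horizontal step $(1,0)$. A lattice path stays weakly south-east of a point $S=(s_1,s_2)$ if every point $(x,y)$ of the path satisfies $x\ge s_1$ or $y\le s_2$ (or both). -}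

module Defs where

open import Data.Integer using (ℤ; _+_; _-_; _≤_; _⊓_; _⊔_; +_; 1ℤ; 0ℤ)
open import Data.Integer.Properties using (_≟_)
open import Data.Nat using (ℕ; zero; suc)
open import Data.Product using (_×_; _,_; proj₁; proj₂)
open import Data.Sum using (_⊎_)
open import Data.List using (List; []; _∷_; last)
open import Data.List.Relation.Unary.All using (All)
open import Data.Maybe using (Maybe; just)
open import Relation.Binary.PropositionalEquality using (_≡_)
open import Relation.Nullary using (does)
open import Data.Bool using (Bool; _∧_; if_then_else_)

Point : Set
Point = ℤ × ℤ

HStep : Point → Point → Set
HStep (x , y) (x' , y') = (x' ≡ x + 1ℤ) × (y' ≡ y)

VStep : Point → Point → Set
VStep (x , y) (x' , y') = (x' ≡ x) × (y' ≡ y + 1ℤ)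

data IsLatticePath : List Point → Set where
  single : ∀ {p} → IsLatticePath (p ∷ [])
  hstep  : ∀ {p q ps} → HStep p q → IsLatticePath (q ∷ ps) → IsLatticePath (p ∷ q ∷ ps)
  vstep  : ∀ {p q ps} → VStep p q → IsLatticePath (q ∷ ps) → IsLatticePath (p ∷ q ∷ ps)

record LatticePathFromTo (A B : Point) : Set where
  constructor mkPath
  field
    rest  : List Point
    valid : IsLatticePath (A ∷ rest)
    ends  : last (A ∷ rest) ≡ just B

open LatticePathFromTo public

points : ∀ {A B} → LatticePathFromTo A B → List Point
points {A} P = A ∷ rest P

isH : Point → Point → Bool
isH (x , y) (x' , y') = does (x' ≟ x + 1ℤ) ∧ does (y' ≟ y)

isV : Point → Point → Bool
isV (x , y) (x' , y') = does (x' ≟ x) ∧ does (y' ≟ y + 1ℤ)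

neTurnsList : List Point → ℕ
neTurnsList (p ∷ q ∷ r ∷ ps) =
  (if isV p q ∧ isH q r then suc (neTurnsList (q ∷ r ∷ ps)) else neTurnsList (q ∷ r ∷ ps))
neTurnsList _ = zero

neTurns : ∀ {A B} → LatticePathFromTo A B → ℕ
neTurns P = neTurnsList (points P)

WeaklySEPoint : Point → Point → Set
WeaklySEPoint (s₁ , s₂) (x , y) = (s₁ ≤ x) ⊎ (y ≤ s₂)

StaysWeaklySE : ∀ {A B} → LatticePathFromTo A B → Point → Set
StaysWeaklySE P S = All (WeaklySEPoint S) (points P)

diff : Point → ℤ
diff (x , y) = x - y

maxDiff : Point → List Point → ℤ
maxDiff s [] = diff s
maxDiff s (t ∷ ts) = diff s ⊔ maxDiff t ts

turnBound : Point → Point → List Point → ℤ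
turnBound (a , b) (c , d) [] = (c - a) ⊓ (d - b)
turnBound (a , b) (c , d) (s ∷ ss) = ((c - a) ⊓ (d - b)) ⊓ ((c - b) - maxDiff s ss)

InBox : Point → Point → Point → Set
InBox (a , b) (c , d) (x , y) = (a ≤ x × x ≤ c) × (b ≤ y × y ≤ d)

-- Every bound comes from a potential φ : ℤ² → ℤ that never decreases along a step and rises by
-- at least one across each NE-turn (the vertical step into the turn followed by the horizontal
-- step out of it); since these step pairs are disjoint, a path from A to B has at most
-- φ B − φ A turns. The potentials are the x-coordinate, the y-coordinate, and, for an obstacle
-- S = (x , y), φ (u , v) = (u ⊔ x) + (v ⊓ y): at a turn strictly left of column x the path is
-- weakly below height y, so the vertical step raises v ⊓ y; otherwise the horizontal step
-- raises u ⊔ x. With T the bound, the staircase of c − a − T east steps, T zig-zags (north,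
-- east) and d − b − T north steps attains it: its zig-zag part hugs the diagonal through the
-- corner (c − T , b), which keeps it weakly south-east of every obstacle (x , y) because
-- T ≤ c − b − (x − y).
module Submission where

open import Defs
open import Data.Integer using (ℤ; _≤_; +_; ∣_∣; _+_; _-_; -_; _⊓_; _⊔_; 1ℤ; 0ℤ)
open import Data.Integer.Properties as ℤ using (_≟_)
open import Data.Integer.Tactic.RingSolver using (solve-∀)
open import Data.Nat as ℕ using (ℕ; zero; suc)
open import Data.Nat.Properties using (+-identityʳ)
open import Data.Bool using (Bool; true; false; _∧_; if_then_else_)
open import Data.Product using (_×_; _,_; proj₁; proj₂; Σ-syntax)
open import Data.Sum using (inj₁; inj₂)
open import Data.List using (List; []; _∷_; _++_; replicate; last)
open import Data.List.Relation.Unary.All as All using (All; []; _∷_)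
open import Data.Maybe using (just)
open import Data.Unit using (⊤; tt)
open import Function using (_∘_)
open import Relation.Binary.PropositionalEquality
  using (_≡_; _≢_; refl; sym; trans; cong; cong₂; subst; module ≡-Reasoning)
open import Relation.Nullary using (yes; no)
open import Relation.Nullary.Decidable using (dec-true; dec-false)

x+1≢x : ∀ x → x + 1ℤ ≢ x
x+1≢x x eq = ℤ.i≢suc[i] (sym (trans (ℤ.+-comm 1ℤ x) eq))

i+j≤k⇒i≤k-j : ∀ {i j k} → i + j ≤ k → i ≤ k - j
i+j≤k⇒i≤k-j {i} {j} {k} le = subst (_≤ k - j) (cancel i j) (ℤ.+-monoˡ-≤ (- j) le)
  where
  cancel : ∀ i j → (i + j) - j ≡ i
  cancel = solve-∀

i≤i+1 : ∀ i → i ≤ i + 1ℤ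
i≤i+1 i = ℤ.i≤i+j i 1ℤ

k-[k-j]≡j : ∀ k j → k - (k - j) ≡ j
k-[k-j]≡j = solve-∀

k-j≤k-i : ∀ k {i j} → i ≤ j → k - j ≤ k - i
k-j≤k-i k i≤j = ℤ.+-monoʳ-≤ k (ℤ.neg-mono-≤ i≤j)

i≤k-j⇒j≤k-i : ∀ {i j k} → i ≤ k - j → j ≤ k - i
i≤k-j⇒j≤k-i {i} {j} {k} i≤k-j = subst (_≤ k - i) (k-[k-j]≡j k j) (k-j≤k-i k i≤k-j)

x+1+n≡x+[1+n] : ∀ x n → (x + 1ℤ) + + n ≡ x + + suc n
x+1+n≡x+[1+n] x n = ℤ.+-assoc x 1ℤ (+ n)

isH-hstep : ∀ {p q} → HStep p q → isH p q ≡ true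
isH-hstep {x , y} (refl , refl) rewrite dec-true (x + 1ℤ ≟ x + 1ℤ) refl | dec-true (y ≟ y) refl = refl

isV-vstep : ∀ {p q} → VStep p q → isV p q ≡ true
isV-vstep {x , y} (refl , refl) rewrite dec-true (x ≟ x) refl | dec-true (y + 1ℤ ≟ y + 1ℤ) refl = refl

isV-hstep : ∀ {p q} → HStep p q → isV p q ≡ false
isV-hstep {x , y} (refl , refl) rewrite dec-false (x + 1ℤ ≟ x) (x+1≢x x) = refl

isH-vstep : ∀ {p q} → VStep p q → isH p q ≡ false
isH-vstep {x , y} (refl , refl) rewrite dec-false (x ≟ x + 1ℤ) (x+1≢x x ∘ sym) = refl

module _ {b c : Bool} {m n : ℕ} where

  if-false-∧ : b ≡ false → (if b ∧ c then m else n) ≡ n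
  if-false-∧ refl = refl

  if-true-∧-false : b ≡ true → c ≡ false → (if b ∧ c then m else n) ≡ n
  if-true-∧-false refl refl = refl

  if-true-∧-true : b ≡ true → c ≡ true → (if b ∧ c then m else n) ≡ m
  if-true-∧-true refl refl = refl

neTurnsList-hstep : ∀ p q ps → HStep p q → neTurnsList (p ∷ q ∷ ps) ≡ neTurnsList (q ∷ ps)
neTurnsList-hstep p q []      h = refl
neTurnsList-hstep p q (_ ∷ _) h = if-false-∧ (isV-hstep {p} {q} h)

neTurnsList-vstep-vstep : ∀ p q r ps → VStep p q → VStep q r →
                          neTurnsList (p ∷ q ∷ r ∷ ps) ≡ neTurnsList (q ∷ r ∷ ps)
neTurnsList-vstep-vstep p q r ps v v′ = if-true-∧-false (isV-vstep {p} {q} v) (isH-vstep {q} {r} v′)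

neTurnsList-turn : ∀ p q r ps → VStep p q → HStep q r →
                   neTurnsList (p ∷ q ∷ r ∷ ps) ≡ suc (neTurnsList (r ∷ ps))
neTurnsList-turn p q r ps v h =
  trans (if-true-∧-true (isV-vstep {p} {q} v) (isH-hstep {q} {r} h)) (cong suc (neTurnsList-hstep q r ps h))

module _ (φ : Point → ℤ) {Q : Point → Set}
         (φ-hstep : ∀ p q → HStep p q → φ p ≤ φ q)
         (φ-vstep : ∀ p q → VStep p q → φ p ≤ φ q)
         (φ-turn : ∀ p q r → VStep p q → HStep q r → Q q → 1ℤ + φ p ≤ φ r)
         where

  private
    extend-past-nonTurn : ∀ p q ps {B} → φ p ≤ φ q →
                          neTurnsList (p ∷ q ∷ ps) ≡ neTurnsList (q ∷ ps) →
                          + neTurnsList (q ∷ ps) + φ q ≤ φ B → + neTurnsList (p ∷ q ∷ ps) + φ p ≤ φ B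
    extend-past-nonTurn p q ps {B} φp≤φq eq bound = begin
      + neTurnsList (p ∷ q ∷ ps) + φ p  ≡⟨ cong (λ n → + n + φ p) eq ⟩
      + neTurnsList (q ∷ ps) + φ p      ≤⟨ ℤ.+-monoʳ-≤ (+ neTurnsList (q ∷ ps)) φp≤φq ⟩
      + neTurnsList (q ∷ ps) + φ q      ≤⟨ bound ⟩
      φ B                               ∎
      where open ℤ.≤-Reasoning

  neTurnsList+φ≤φ-last : ∀ {p ps B} → IsLatticePath (p ∷ ps) → All Q (p ∷ ps) →
                         last (p ∷ ps) ≡ just B → + neTurnsList (p ∷ ps) + φ p ≤ φ B
  neTurnsList+φ≤φ-last {p} single _ refl = ℤ.≤-reflexive (ℤ.+-identityˡ (φ p))
  neTurnsList+φ≤φ-last {p} {q ∷ ps} (hstep h path) (_ ∷ qs) e =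
    extend-past-nonTurn p q ps (φ-hstep p q h) (neTurnsList-hstep p q ps h)
      (neTurnsList+φ≤φ-last path qs e)
  neTurnsList+φ≤φ-last {p} {q ∷ []} (vstep v single) (_ ∷ qs) e =
    extend-past-nonTurn p q [] (φ-vstep p q v) refl (neTurnsList+φ≤φ-last single qs e)
  neTurnsList+φ≤φ-last {p} {q ∷ r ∷ ps} (vstep v (vstep v′ path)) (_ ∷ qs) e =
    extend-past-nonTurn p q (r ∷ ps) (φ-vstep p q v) (neTurnsList-vstep-vstep p q r ps v v′)
      (neTurnsList+φ≤φ-last (vstep v′ path) qs e)
  neTurnsList+φ≤φ-last {p} {q ∷ r ∷ ps} {B} (vstep v (hstep h path)) (_ ∷ q∈Q ∷ rs) e = begin
    + neTurnsList (p ∷ q ∷ r ∷ ps) + φ p  ≡⟨ cong (λ n → + n + φ p) (neTurnsList-turn p q r ps v h) ⟩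
    (1ℤ + + n) + φ p                      ≡⟨ regroup (+ n) (φ p) ⟩
    + n + (1ℤ + φ p)                      ≤⟨ ℤ.+-monoʳ-≤ (+ n) (φ-turn p q r v h q∈Q) ⟩
    + n + φ r                             ≤⟨ neTurnsList+φ≤φ-last path rs e ⟩
    φ B                                   ∎
    where
    open ℤ.≤-Reasoning
    n = neTurnsList (r ∷ ps)
    regroup : ∀ i j → (1ℤ + i) + j ≡ i + (1ℤ + j)
    regroup = solve-∀

  neTurns≤φ-gain : ∀ {A B} (P : LatticePathFromTo A B) → All Q (points P) → + neTurns P ≤ φ B - φ A
  neTurns≤φ-gain (mkPath _ valid ends) Qs = i+j≤k⇒i≤k-j (neTurnsList+φ≤φ-last valid Qs ends)

neTurns≤width : ∀ {a b c d} (P : LatticePathFromTo (a , b) (c , d)) → + neTurns P ≤ c - a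
neTurns≤width P = neTurns≤φ-gain proj₁ {Q = λ _ → ⊤} east north turn P (All.universal (λ _ → tt) _)
  where
  east : ∀ p q → HStep p q → proj₁ p ≤ proj₁ q
  east (x , _) _ (refl , refl) = i≤i+1 x
  north : ∀ p q → VStep p q → proj₁ p ≤ proj₁ q
  north _ _ (refl , refl) = ℤ.≤-refl
  turn : ∀ p q r → VStep p q → HStep q r → ⊤ → 1ℤ + proj₁ p ≤ proj₁ r
  turn (x , _) _ _ (refl , refl) (refl , refl) _ = ℤ.≤-reflexive (ℤ.+-comm 1ℤ x)

neTurns≤height : ∀ {a b c d} (P : LatticePathFromTo (a , b) (c , d)) → + neTurns P ≤ d - b
neTurns≤height P = neTurns≤φ-gain proj₂ {Q = λ _ → ⊤} east north turn P (All.universal (λ _ → tt) _)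
  where
  east : ∀ p q → HStep p q → proj₂ p ≤ proj₂ q
  east _ _ (refl , refl) = ℤ.≤-refl
  north : ∀ p q → VStep p q → proj₂ p ≤ proj₂ q
  north (_ , y) _ (refl , refl) = i≤i+1 y
  turn : ∀ p q r → VStep p q → HStep q r → ⊤ → 1ℤ + proj₂ p ≤ proj₂ r
  turn (_ , y) _ _ (refl , refl) (refl , refl) _ = ℤ.≤-reflexive (ℤ.+-comm 1ℤ y)

obstaclePotential : Point → Point → ℤ
obstaclePotential (x , y) (u , v) = (u ⊔ x) + (v ⊓ y)

module _ {x y : ℤ} where
  private
    ψ = obstaclePotential (x , y)

  obstaclePotential-hstep : ∀ p q → HStep p q → ψ p ≤ ψ q
  obstaclePotential-hstep (u , v) _ (refl , refl) =
    ℤ.+-monoˡ-≤ (v ⊓ y) (ℤ.⊔-monoˡ-≤ x (i≤i+1 u))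

  obstaclePotential-vstep : ∀ p q → VStep p q → ψ p ≤ ψ q
  obstaclePotential-vstep (u , v) _ (refl , refl) =
    ℤ.+-monoʳ-≤ (u ⊔ x) (ℤ.⊓-monoˡ-≤ y (i≤i+1 v))

  obstaclePotential-turn : ∀ p q r → VStep p q → HStep q r → WeaklySEPoint (x , y) q → 1ℤ + ψ p ≤ ψ r
  obstaclePotential-turn (u , v) _ _ (refl , refl) (refl , refl) (inj₁ x≤u) = begin
    1ℤ + ((u ⊔ x) + (v ⊓ y))        ≡⟨ cong (λ w → 1ℤ + (w + (v ⊓ y))) (ℤ.i≥j⇒i⊔j≡i x≤u) ⟩
    1ℤ + (u + (v ⊓ y))              ≡⟨ regroup u (v ⊓ y) ⟩
    (u + 1ℤ) + (v ⊓ y)              ≡⟨ cong (_+ (v ⊓ y))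
                                              (sym (ℤ.i≥j⇒i⊔j≡i (ℤ.≤-trans x≤u (i≤i+1 u)))) ⟩
    ((u + 1ℤ) ⊔ x) + (v ⊓ y)        ≤⟨ ℤ.+-monoʳ-≤ ((u + 1ℤ) ⊔ x) (ℤ.⊓-monoˡ-≤ y (i≤i+1 v)) ⟩
    ((u + 1ℤ) ⊔ x) + ((v + 1ℤ) ⊓ y) ∎
    where
    open ℤ.≤-Reasoning
    regroup : ∀ i j → 1ℤ + (i + j) ≡ (i + 1ℤ) + j
    regroup = solve-∀
  obstaclePotential-turn (u , v) _ _ (refl , refl) (refl , refl) (inj₂ v+1≤y) = begin
    1ℤ + ((u ⊔ x) + (v ⊓ y))        ≡⟨ cong (λ w → 1ℤ + ((u ⊔ x) + w))
                                              (ℤ.i≤j⇒i⊓j≡i (ℤ.≤-trans (i≤i+1 v) v+1≤y)) ⟩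
    1ℤ + ((u ⊔ x) + v)              ≡⟨ regroup (u ⊔ x) v ⟩
    (u ⊔ x) + (v + 1ℤ)              ≡⟨ cong (λ w → (u ⊔ x) + w) (sym (ℤ.i≤j⇒i⊓j≡i v+1≤y)) ⟩
    (u ⊔ x) + ((v + 1ℤ) ⊓ y)        ≤⟨ ℤ.+-monoˡ-≤ ((v + 1ℤ) ⊓ y) (ℤ.⊔-monoˡ-≤ x (i≤i+1 u)) ⟩
    ((u + 1ℤ) ⊔ x) + ((v + 1ℤ) ⊓ y) ∎
    where
    open ℤ.≤-Reasoning
    regroup : ∀ i j → 1ℤ + (i + j) ≡ i + (j + 1ℤ)
    regroup = solve-∀

neTurns≤obstacleGap : ∀ {a b c d x y} (P : LatticePathFromTo (a , b) (c , d)) →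
                      a ≤ x → x ≤ c → b ≤ y → StaysWeaklySE P (x , y) →
                      + neTurns P ≤ (c - b) - (x - y)
neTurns≤obstacleGap {a} {b} {c} {d} {x} {y} P a≤x x≤c b≤y se = begin
  + neTurns P                                     ≤⟨ neTurns≤φ-gain ψ obstaclePotential-hstep
                                                      obstaclePotential-vstep obstaclePotential-turn P se ⟩
  ((c ⊔ x) + (d ⊓ y)) - ((a ⊔ x) + (b ⊓ y))       ≡⟨ cong₂ (λ i j → (i + (d ⊓ y)) - j)
                                                           (ℤ.i≥j⇒i⊔j≡i x≤c) ψ-start ⟩
  (c + (d ⊓ y)) - (x + b)                         ≤⟨ ℤ.+-monoˡ-≤ (- (x + b)) (ℤ.+-monoʳ-≤ c (ℤ.i⊓j≤j d y)) ⟩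
  (c + y) - (x + b)                               ≡⟨ regroup c y x b ⟩
  (c - b) - (x - y)                               ∎
  where
  open ℤ.≤-Reasoning
  ψ = obstaclePotential (x , y)
  ψ-start : (a ⊔ x) + (b ⊓ y) ≡ x + b
  ψ-start = cong₂ _+_ (ℤ.i≤j⇒i⊔j≡j a≤x) (ℤ.i≤j⇒i⊓j≡i b≤y)
  regroup : ∀ c y x b → (c + y) - (x + b) ≡ (c - b) - (x - y)
  regroup = solve-∀

maxDiff-lub : ∀ {M} s ss → All (λ t → diff t ≤ M) (s ∷ ss) → maxDiff s ss ≤ M
maxDiff-lub s []       (s≤M ∷ [])  = s≤M
maxDiff-lub s (t ∷ ts) (s≤M ∷ ts≤M) = ℤ.⊔-lub s≤M (maxDiff-lub t ts ts≤M)

diff≤maxDiff : ∀ s ss → All (λ t → diff t ≤ maxDiff s ss) (s ∷ ss)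
diff≤maxDiff s []       = ℤ.≤-refl ∷ []
diff≤maxDiff s (t ∷ ts) =
  ℤ.i≤i⊔j (diff s) _ ∷ All.map (λ le → ℤ.≤-trans le (ℤ.i≤j⊔i (diff s) _)) (diff≤maxDiff t ts)

module _ {a b c d : ℤ} where

  ≤-turnBound : ∀ {i} S → i ≤ c - a → i ≤ d - b → All (λ s → i ≤ (c - b) - diff s) S →
                i ≤ turnBound (a , b) (c , d) S
  ≤-turnBound []       i≤w i≤h _ = ℤ.⊓-glb i≤w i≤h
  ≤-turnBound (s ∷ ss) i≤w i≤h i≤gaps =
    ℤ.⊓-glb (ℤ.⊓-glb i≤w i≤h)
            (i≤k-j⇒j≤k-i {k = c - b} (maxDiff-lub s ss (All.map (i≤k-j⇒j≤k-i {k = c - b}) i≤gaps)))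

  turnBound≤width : ∀ S → turnBound (a , b) (c , d) S ≤ c - a
  turnBound≤width []      = ℤ.i⊓j≤i _ _
  turnBound≤width (_ ∷ _) = ℤ.≤-trans (ℤ.i⊓j≤i _ _) (ℤ.i⊓j≤i _ _)

  turnBound≤height : ∀ S → turnBound (a , b) (c , d) S ≤ d - b
  turnBound≤height []      = ℤ.i⊓j≤j _ _
  turnBound≤height (_ ∷ _) = ℤ.≤-trans (ℤ.i⊓j≤i _ _) (ℤ.i⊓j≤j _ _)

  turnBound≤obstacleGaps : ∀ S → All (λ s → turnBound (a , b) (c , d) S ≤ (c - b) - diff s) S
  turnBound≤obstacleGaps []       = []
  turnBound≤obstacleGaps (s ∷ ss) =
    All.map (λ le → ℤ.≤-trans (ℤ.i⊓j≤j _ _) (k-j≤k-i (c - b) le)) (diff≤maxDiff s ss)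

  0≤turnBound : ∀ S → a ≤ c → b ≤ d → All (InBox (a , b) (c , d)) S → 0ℤ ≤ turnBound (a , b) (c , d) S
  0≤turnBound S a≤c b≤d boxes =
    ≤-turnBound S (ℤ.i≤j⇒0≤j-i a≤c) (ℤ.i≤j⇒0≤j-i b≤d) (All.map 0≤gap boxes)
    where
    0≤gap : ∀ {s} → InBox (a , b) (c , d) s → 0ℤ ≤ (c - b) - diff s
    0≤gap {x , y} ((_ , x≤c) , (b≤y , _)) =
      subst (0ℤ ≤_) (regroup c x y b) (ℤ.+-mono-≤ (ℤ.i≤j⇒0≤j-i x≤c) (ℤ.i≤j⇒0≤j-i b≤y))
      where
      regroup : ∀ c x y b → (c - x) + (y - b) ≡ (c - b) - (x - y)
      regroup = solve-∀

  neTurns≤turnBound : ∀ S → All (InBox (a , b) (c , d)) S → (P : LatticePathFromTo (a , b) (c , d)) →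
                      All (StaysWeaklySE P) S → + neTurns P ≤ turnBound (a , b) (c , d) S
  neTurns≤turnBound S boxes P stays =
    ≤-turnBound S (neTurns≤width P) (neTurns≤height P) (All.zipWith gap (boxes , stays))
    where
    gap : ∀ {s} → InBox (a , b) (c , d) s × StaysWeaklySE P s → + neTurns P ≤ (c - b) - diff s
    gap {x , y} (((a≤x , x≤c) , (b≤y , _)) , se) = neTurns≤obstacleGap P a≤x x≤c b≤y se

data Move : Set where
  east north : Move

move : Move → Point → Point
move east  (x , y) = (x + 1ℤ , y)
move north (x , y) = (x , y + 1ℤ)

walk : Point → List Move → List Point
walk p []       = []
walk p (m ∷ ms) = move m p ∷ walk (move m p) ms

endpoint : Point → List Move → Point
endpoint p []       = p
endpoint p (m ∷ ms) = endpoint (move m p) ms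

walk-isLatticePath : ∀ p ms → IsLatticePath (p ∷ walk p ms)
walk-isLatticePath p []           = single
walk-isLatticePath p (east ∷ ms)  = hstep (refl , refl) (walk-isLatticePath _ ms)
walk-isLatticePath p (north ∷ ms) = vstep (refl , refl) (walk-isLatticePath _ ms)

last-walk : ∀ p ms → last (p ∷ walk p ms) ≡ just (endpoint p ms)
last-walk p []       = refl
last-walk p (m ∷ ms) = last-walk (move m p) ms

pathAlong : ∀ {A B} ms → endpoint A ms ≡ B → LatticePathFromTo A B
pathAlong {A} ms A↝B =
  mkPath (walk A ms) (walk-isLatticePath A ms) (trans (last-walk A ms) (cong just A↝B))

endpoint-++ : ∀ p ms ns → endpoint p (ms ++ ns) ≡ endpoint (endpoint p ms) ns
endpoint-++ p []       ns = refl
endpoint-++ p (m ∷ ms) ns = endpoint-++ (move m p) ms ns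

All-walk-++ : ∀ {Q : Point → Set} p ms ns → All Q (p ∷ walk p ms) →
              All Q (endpoint p ms ∷ walk (endpoint p ms) ns) → All Q (p ∷ walk p (ms ++ ns))
All-walk-++ p []       ns _          rest = rest
All-walk-++ p (m ∷ ms) ns (Qp ∷ Qms) rest = Qp ∷ All-walk-++ (move m p) ms ns Qms rest

zigzag : ℕ → List Move
zigzag zero    = []
zigzag (suc t) = north ∷ east ∷ zigzag t

staircase : ℕ → ℕ → ℕ → List Move
staircase h t k = replicate h east ++ zigzag t ++ replicate k north

neTurnsList-eastRun : ∀ p h ms →
  neTurnsList (p ∷ walk p (replicate h east ++ ms))
    ≡ neTurnsList (endpoint p (replicate h east) ∷ walk (endpoint p (replicate h east)) ms)
neTurnsList-eastRun p zero    ms = refl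
neTurnsList-eastRun p (suc h) ms =
  trans (neTurnsList-hstep p (move east p) (walk (move east p) (replicate h east ++ ms)) (refl , refl))
        (neTurnsList-eastRun (move east p) h ms)

neTurnsList-zigzag : ∀ p t ms →
  neTurnsList (p ∷ walk p (zigzag t ++ ms))
    ≡ t ℕ.+ neTurnsList (endpoint p (zigzag t) ∷ walk (endpoint p (zigzag t)) ms)
neTurnsList-zigzag p zero    ms = refl
neTurnsList-zigzag p (suc t) ms =
  trans (neTurnsList-turn p q r (walk r (zigzag t ++ ms)) (refl , refl) (refl , refl))
        (cong suc (neTurnsList-zigzag r t ms))
  where
  q = move north p
  r = move east q

neTurnsList-northRun : ∀ p k → neTurnsList (p ∷ walk p (replicate k north)) ≡ 0
neTurnsList-northRun p zero          = refl
neTurnsList-northRun p (suc zero)    = refl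
neTurnsList-northRun p (suc (suc k)) =
  trans (neTurnsList-vstep-vstep p q r (walk r (replicate k north)) (refl , refl) (refl , refl))
        (neTurnsList-northRun q (suc k))
  where
  q = move north p
  r = move north q

neTurnsList-staircase : ∀ p h t k → neTurnsList (p ∷ walk p (staircase h t k)) ≡ t
neTurnsList-staircase p h t k = begin
  neTurnsList (p ∷ walk p (staircase h t k))                           ≡⟨ neTurnsList-eastRun p h _ ⟩
  neTurnsList (q ∷ walk q (zigzag t ++ replicate k north))             ≡⟨ neTurnsList-zigzag q t _ ⟩
  t ℕ.+ neTurnsList (r ∷ walk r (replicate k north))                   ≡⟨ cong (t ℕ.+_) (neTurnsList-northRun r k) ⟩
  t ℕ.+ 0                                                              ≡⟨ +-identityʳ t ⟩
  t                                                                    ∎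
  where
  open ≡-Reasoning
  q = endpoint p (replicate h east)
  r = endpoint q (zigzag t)

endpoint-eastRun : ∀ x y h → endpoint (x , y) (replicate h east) ≡ (x + + h , y)
endpoint-eastRun x y zero    = cong (_, y) (sym (ℤ.+-identityʳ x))
endpoint-eastRun x y (suc h) = trans (endpoint-eastRun (x + 1ℤ) y h) (cong (_, y) (x+1+n≡x+[1+n] x h))

endpoint-northRun : ∀ x y k → endpoint (x , y) (replicate k north) ≡ (x , y + + k)
endpoint-northRun x y zero    = cong (x ,_) (sym (ℤ.+-identityʳ y))
endpoint-northRun x y (suc k) = trans (endpoint-northRun x (y + 1ℤ) k) (cong (x ,_) (x+1+n≡x+[1+n] y k))

endpoint-zigzag : ∀ x y t → endpoint (x , y) (zigzag t) ≡ (x + + t , y + + t)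
endpoint-zigzag x y zero    = cong₂ _,_ (sym (ℤ.+-identityʳ x)) (sym (ℤ.+-identityʳ y))
endpoint-zigzag x y (suc t) =
  trans (endpoint-zigzag (x + 1ℤ) (y + 1ℤ) t) (cong₂ _,_ (x+1+n≡x+[1+n] x t) (x+1+n≡x+[1+n] y t))

endpoint-eastRun-zigzag : ∀ x y h t →
  endpoint (endpoint (x , y) (replicate h east)) (zigzag t) ≡ ((x + + h) + + t , y + + t)
endpoint-eastRun-zigzag x y h t =
  trans (cong (λ p → endpoint p (zigzag t)) (endpoint-eastRun x y h)) (endpoint-zigzag (x + + h) y t)

endpoint-staircase : ∀ x y h t k →
                     endpoint (x , y) (staircase h t k) ≡ ((x + + h) + + t , (y + + t) + + k)
endpoint-staircase x y h t k = begin
  endpoint (x , y) (staircase h t k)                        ≡⟨ endpoint-++ (x , y) (replicate h east) _ ⟩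
  endpoint q (zigzag t ++ replicate k north)                ≡⟨ endpoint-++ q (zigzag t) _ ⟩
  endpoint (endpoint q (zigzag t)) (replicate k north)      ≡⟨ cong (λ p → endpoint p (replicate k north))
                                                                    (endpoint-eastRun-zigzag x y h t) ⟩
  endpoint ((x + + h) + + t , y + + t) (replicate k north)  ≡⟨ endpoint-northRun _ _ k ⟩
  ((x + + h) + + t , (y + + t) + + k)                       ∎
  where
  open ≡-Reasoning
  q = endpoint (x , y) (replicate h east)

weaklySE-nearDiagonal : ∀ {x y u v} → diff (x , y) ≤ (1ℤ + u) - v → WeaklySEPoint (x , y) (u , v)
weaklySE-nearDiagonal {x} {y} {u} {v} near with x ℤ.≤? u
... | yes x≤u = inj₁ x≤u
... | no  x≰u = inj₂ (begin
  v                    ≤⟨ i≤k-j⇒j≤k-i {k = 1ℤ + u} near ⟩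
  (1ℤ + u) - (x - y)   ≤⟨ ℤ.+-monoˡ-≤ (- (x - y)) (ℤ.i<j⇒suc[i]≤j (ℤ.≰⇒> x≰u)) ⟩
  x - (x - y)          ≡⟨ k-[k-j]≡j x y ⟩
  y                    ∎)
  where open ℤ.≤-Reasoning

eastRun-weaklySE : ∀ {S} h p → proj₂ p ≤ proj₂ S → All (WeaklySEPoint S) (p ∷ walk p (replicate h east))
eastRun-weaklySE zero    p below = inj₂ below ∷ []
eastRun-weaklySE (suc h) p below = inj₂ below ∷ eastRun-weaklySE h (move east p) below

northRun-weaklySE : ∀ {S} k p → proj₁ S ≤ proj₁ p → All (WeaklySEPoint S) (p ∷ walk p (replicate k north))
northRun-weaklySE zero    p right = inj₁ right ∷ []
northRun-weaklySE (suc k) p right = inj₁ right ∷ northRun-weaklySE k (move north p) right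

weaklySE-onDiagonal : ∀ {S} p → diff S ≤ diff p → WeaklySEPoint S p
weaklySE-onDiagonal (u , v) below = weaklySE-nearDiagonal (ℤ.≤-trans below (ℤ.+-monoˡ-≤ (- v) u≤1+u))
  where
  u≤1+u : u ≤ 1ℤ + u
  u≤1+u = ℤ.≤-trans (i≤i+1 u) (ℤ.≤-reflexive (ℤ.+-comm u 1ℤ))

zigzag-weaklySE : ∀ {S} t p → diff S ≤ diff p → All (WeaklySEPoint S) (p ∷ walk p (zigzag t))
zigzag-weaklySE zero    p below = weaklySE-onDiagonal p below ∷ []
zigzag-weaklySE {S} (suc t) (u , v) below =
  weaklySE-onDiagonal (u , v) below
  ∷ weaklySE-nearDiagonal (subst (diff S ≤_) (north-shift u v) below)
  ∷ zigzag-weaklySE t (u + 1ℤ , v + 1ℤ) (subst (diff S ≤_) (east-north-shift u v) below)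
  where
  north-shift : ∀ u v → u - v ≡ (1ℤ + u) - (v + 1ℤ)
  north-shift = solve-∀
  east-north-shift : ∀ u v → u - v ≡ (u + 1ℤ) - (v + 1ℤ)
  east-north-shift = solve-∀

staircase-weaklySE : ∀ {x y} a b h t k → b ≤ y → x ≤ (a + + h) + + t → x - y ≤ (a + + h) - b →
                     All (WeaklySEPoint (x , y)) ((a , b) ∷ walk (a , b) (staircase h t k))
staircase-weaklySE {x} {y} a b h t k b≤y x≤end below =
  All-walk-++ (a , b) (replicate h east) _ (eastRun-weaklySE h (a , b) b≤y)
    (All-walk-++ q (zigzag t) _ (zigzag-weaklySE t q below-q) (northRun-weaklySE k r right-of-r))
  where
  q = endpoint (a , b) (replicate h east)
  r = endpoint q (zigzag t)
  below-q : x - y ≤ diff q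
  below-q = subst (λ p → x - y ≤ diff p) (sym (endpoint-eastRun a b h)) below
  right-of-r : x ≤ proj₁ r
  right-of-r = subst (λ p → x ≤ proj₁ p) (sym (endpoint-eastRun-zigzag a b h t)) x≤end

staircase-attains-turnBound :
  ∀ {a b c d} S → a ≤ c → b ≤ d → All (InBox (a , b) (c , d)) S →
  Σ[ P ∈ LatticePathFromTo (a , b) (c , d) ]
    (All (StaysWeaklySE P) S × + neTurns P ≡ turnBound (a , b) (c , d) S)
staircase-attains-turnBound {a} {b} {c} {d} S a≤c b≤d boxes =
  pathAlong (staircase h t k) reaches ,
  All.zipWith stays (boxes , turnBound≤obstacleGaps S) ,
  trans (cong +_ (neTurnsList-staircase (a , b) h t k)) +t≡T
  where
  T = turnBound (a , b) (c , d) S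
  t = ∣ T ∣
  h = ∣ (c - a) - T ∣
  k = ∣ (d - b) - T ∣

  +t≡T : + t ≡ T
  +t≡T = ℤ.0≤i⇒+∣i∣≡i (0≤turnBound S a≤c b≤d boxes)
  +h≡c-a-T : + h ≡ (c - a) - T
  +h≡c-a-T = ℤ.0≤i⇒+∣i∣≡i (ℤ.i≤j⇒0≤j-i (turnBound≤width {a} {b} {c} {d} S))
  +k≡d-b-T : + k ≡ (d - b) - T
  +k≡d-b-T = ℤ.0≤i⇒+∣i∣≡i (ℤ.i≤j⇒0≤j-i (turnBound≤height {a} {b} {c} {d} S))

  a+h≡c-T : a + + h ≡ c - T
  a+h≡c-T = trans (cong (λ w → a + w) +h≡c-a-T) (i+[j-i-k]≡j-k a c T)
    where
    i+[j-i-k]≡j-k : ∀ i j k → i + ((j - i) - k) ≡ j - k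
    i+[j-i-k]≡j-k = solve-∀
  column : (a + + h) + + t ≡ c
  column = trans (cong₂ _+_ a+h≡c-T +t≡T) (i-j+j≡i c T)
    where
    i-j+j≡i : ∀ i j → (i - j) + j ≡ i
    i-j+j≡i = solve-∀
  row : (b + + t) + + k ≡ d
  row = trans (cong₂ (λ i j → (b + i) + j) +t≡T +k≡d-b-T) (i+k+[j-i-k]≡j b d T)
    where
    i+k+[j-i-k]≡j : ∀ i j k → (i + k) + ((j - i) - k) ≡ j
    i+k+[j-i-k]≡j = solve-∀

  reaches : endpoint (a , b) (staircase h t k) ≡ (c , d)
  reaches = trans (endpoint-staircase a b h t k) (cong₂ _,_ column row)

  stays : ∀ {s} → InBox (a , b) (c , d) s × T ≤ (c - b) - diff s →
          StaysWeaklySE (pathAlong {a , b} (staircase h t k) reaches) s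
  stays {x , y} (((_ , x≤c) , (b≤y , _)) , T≤gap) =
    staircase-weaklySE a b h t k b≤y (subst (x ≤_) (sym column) x≤c) below-corner
    where
    swap-b-T : ∀ c b T → (c - b) - T ≡ (c - T) - b
    swap-b-T = solve-∀
    below-corner : x - y ≤ (a + + h) - b
    below-corner = subst (x - y ≤_) (trans (swap-b-T c b T) (cong (_- b) (sym a+h≡c-T)))
                         (i≤k-j⇒j≤k-i {k = c - b} T≤gap)

lemma4 : (a b c d : ℤ) (S : List Point) →
    a ≤ c → b ≤ d →
    All (InBox (a , b) (c , d)) S →
    ((P : LatticePathFromTo (a , b) (c , d)) →
        All (StaysWeaklySE P) S →
        + neTurns P ≤ turnBound (a , b) (c , d) S)
    × (Σ[ P ∈ LatticePathFromTo (a , b) (c , d) ]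
        (All (StaysWeaklySE P) S × + neTurns P ≡ turnBound (a , b) (c , d) S))
lemma4 a b c d S a≤c b≤d boxes =
  neTurns≤turnBound S boxes , staircase-attains-turnBound S a≤c b≤d boxes
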